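{- If $H$ is a non-uniform multi-hypergraph, then $\mathcal{E}^*_H(k)\leq 2(k-1)$ for every positive integer $k$. Additionally, if $\mathcal{H}$ is a finite family of non-uniform multi-hypergraphs, then $\mathcal{E}^*_\mathcal{H}(k)$ is finite for every $k$.
   Context: Hypergraphs have edges that are nonempty finite subsets of the vertex set, possibly of different sizes; multi-hypergraphs may have repeated edges. A multi-hypergraph is non-uniform if it has two edges of different sizes. $\operatorname{ex}(G,\mathcal{H})$ is the maximum number of edges of a sub-hypergraph of $G$ containing no copy of any member of $\mathcal{H}$, and $\mathcal{E}^*_\mathcal{H}(k):=\sup\{e(G): G \text{ a multi-hypergraph}, \operatorname{ex}(G,\mathcal{H})<k\}$, with $\mathcal{E}^*_H=\mathcal{E}^*_{\{H\}}$. -}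

module Defs where

open import Data.Nat using (ℕ; _<_)
open import Data.Fin using (Fin)
open import Data.Fin.Subset using (Subset; _∈_; Nonempty; ∣_∣)
open import Data.List using (List; length; lookup)
open import Data.List.Relation.Unary.All using (All)
open import Data.List.Relation.Unary.Any using (Any)
open import Data.List.Relation.Binary.Sublist.Propositional using (_⊆_)
open import Data.Product using (Σ; ∃; _×_; _,_)
open import Relation.Binary.PropositionalEquality using (_≡_; _≢_)
open import Relation.Nullary using (¬_)
open import Function.Bundles using (_⇔_)
open import Function.Definitions using (Injective)

-- A (finite) multi-hypergraph: vertex set Fin n, a finite list of edges
-- (repetitions allowed), each edge a nonempty subset of the vertex set.
record MultiHypergraph : Set where
  constructor mkMH
  field
    n        : ℕ
    edges    : List (Subset n)
    nonempty : All Nonempty edges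
open MultiHypergraph public

e : MultiHypergraph → ℕ
e G = length (edges G)

NonUniform : MultiHypergraph → Set
NonUniform H =
  Σ (Fin (e H)) λ i → Σ (Fin (e H)) λ j →
    (∣ lookup (edges H) i ∣) ≢ (∣ lookup (edges H) j ∣)

IsImage : {m k : ℕ} → (Fin m → Fin k) → Subset m → Subset k → Set
IsImage {m} φ A B = ∀ w → (w ∈ B) ⇔ (Σ (Fin m) λ v → (v ∈ A) × (φ v ≡ w))

-- a copy of H in a multiset of edges fs over the vertex set Fin k:
-- an injective vertex map φ and an injective edge map ψ with
-- ψ(f) = φ(f) for every edge f of H (multiplicities respected by injectivity of ψ)
ContainsCopy : {k : ℕ} → List (Subset k) → MultiHypergraph → Set
ContainsCopy {k} fs H =
  Σ (Fin (n H) → Fin k) λ φ → Injective _≡_ _≡_ φ ×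
  Σ (Fin (e H) → Fin (length fs)) λ ψ → Injective _≡_ _≡_ ψ ×
    (∀ i → IsImage φ (lookup (edges H) i) (lookup fs (ψ i)))

Free : {k : ℕ} → List (Subset k) → List MultiHypergraph → Set
Free fs ℋ = ¬ Any (ContainsCopy fs) ℋ

-- ex(G, ℋ) < k : every ℋ-free sub-hypergraph of G has fewer than k edges
-- (sub-hypergraphs: same vertex set, sub-multiset of the edges)
ExLess : MultiHypergraph → List MultiHypergraph → ℕ → Set
ExLess G ℋ k = ∀ (fs : List (Subset (n G))) → fs ⊆ edges G → Free fs ℋ → length fs < k

EStarLe : List MultiHypergraph → ℕ → ℕ → Set
EStarLe ℋ k B = ∀ (G : MultiHypergraph) → ExLess G ℋ k → e G Data.Nat.≤ B

EStarFinite : List MultiHypergraph → ℕ → Set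
EStarFinite ℋ k = ∃ λ B → EStarLe ℋ k B

-- Copies preserve edge sizes, so a copy of a non-uniform H never lies inside a uniform
-- edge set, nor inside an edge set avoiding the size s of some fixed edge of H. Given
-- ℋ = H₁, …, Hₘ with chosen edge sizes s₁, …, sₘ, split the edges of G into the m classes
-- "size sⱼ" and the class of edges avoiding every sⱼ. Each class is ℋ-free, so if
-- ex(G, ℋ) < k it has at most k − 1 edges, and e(G) ≤ (m + 1)(k − 1).
module Submission where

open import Defs
open import Data.Bool using (true; false)
open import Data.Empty using (⊥; ⊥-elim)
open import Data.Nat using (ℕ; zero; suc; _+_; _*_; _∸_; _≤_; _≟_)
open import Data.Nat.Properties using (<⇒≤pred; +-mono-≤; *-identityˡ; +-suc; module ≤-Reasoning)
open import Data.Fin using (Fin; zero; suc)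
open import Data.Fin.Properties using (suc-injective)
open import Data.Fin.Subset using (Subset; inside; outside; ⁅_⁆; _─_; _-_; _∈_; _∉_; Empty; ∣_∣)
open import Data.Fin.Subset.Properties
  using (Empty-unique; ∣⊥∣≡0; p─⊥≡p; p─q⊆p; x∈p∧x≢y⇒x∈p-y; x∉⁅y⁆⇒x≢y)
import Data.Vec as Vec
open import Data.Vec using (_∷_; here; there)
open import Data.List using (List; []; _∷_; [_]; lookup; length; filter)
import Data.List.Relation.Unary.All as All
open import Data.List.Relation.Unary.All using (All)
open import Data.List.Relation.Unary.All.Properties using (all-filter; All¬⇒¬Any)
import Data.List.Relation.Unary.Any as Any
open import Data.List.Relation.Unary.Any using (Any)
open import Data.List.Membership.Propositional.Properties using (∈-lookup)
open import Data.List.Relation.Binary.Sublist.Propositional using (_⊆_; ⊆-refl; ⊆-trans)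
open import Data.List.Relation.Binary.Sublist.Propositional.Properties using (filter-⊆; All-resp-⊆)
open import Data.Product using (Σ; _×_; _,_; proj₁)
open import Relation.Nullary using (¬_; does)
open import Relation.Unary using (Decidable)
open import Relation.Unary.Properties using (∁?)
open import Relation.Binary.PropositionalEquality
  using (_≡_; _≢_; refl; sym; trans; cong; module ≡-Reasoning)
open import Function.Base using (_∘_)
open import Function.Bundles using (mk⇔; Equivalence)
open import Function.Definitions using (Injective)

x∈p─q⇒x∉q : ∀ {n} {x : Fin n} (p q : Subset n) → x ∈ p ─ q → x ∉ q
x∈p─q⇒x∉q (_ ∷ p) (outside ∷ q) here          ()
x∈p─q⇒x∉q (_ ∷ p) (_       ∷ q) (there x∈p─q) (there x∈q) = x∈p─q⇒x∉q p q x∈p─q x∈q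

x∈p-y⇒x≢y : ∀ {n} {x y : Fin n} {p : Subset n} → x ∈ p - y → x ≢ y
x∈p-y⇒x≢y {y = y} {p} x∈p-y = x∉⁅y⁆⇒x≢y (x∈p─q⇒x∉q p ⁅ y ⁆ x∈p-y)

x∈p⇒∣p∣≡1+∣p-x∣ : ∀ {n} {x : Fin n} {p : Subset n} → x ∈ p → ∣ p ∣ ≡ suc ∣ p - x ∣
x∈p⇒∣p∣≡1+∣p-x∣ {p = inside ∷ p}  here        = cong (λ q → suc ∣ q ∣) (sym (p─⊥≡p p))
x∈p⇒∣p∣≡1+∣p-x∣ {p = inside ∷ p}  (there x∈p) = cong suc (x∈p⇒∣p∣≡1+∣p-x∣ x∈p)
x∈p⇒∣p∣≡1+∣p-x∣ {p = outside ∷ p} (there x∈p) = x∈p⇒∣p∣≡1+∣p-x∣ x∈p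

Empty⇒∣p∣≡0 : ∀ {n} {p : Subset n} → Empty p → ∣ p ∣ ≡ 0
Empty⇒∣p∣≡0 {n} empty = trans (cong ∣_∣ (Empty-unique empty)) (∣⊥∣≡0 n)

module _ {m k : ℕ} {φ : Fin (suc m) → Fin k} {A : Subset m} {B : Subset k} where

  IsImage-outside : IsImage φ (outside ∷ A) B → IsImage (φ ∘ suc) A B
  IsImage-outside img w = mk⇔
    (λ w∈B → drop-zero (Equivalence.to (img w) w∈B))
    (λ (v , v∈A , φv≡w) → Equivalence.from (img w) (suc v , there v∈A , φv≡w))
    where
    drop-zero : Σ (Fin (suc m)) (λ v → v ∈ outside ∷ A × φ v ≡ w) →
                Σ (Fin m) (λ v → v ∈ A × φ (suc v) ≡ w)
    drop-zero (suc v , there v∈A , φv≡w) = v , v∈A , φv≡w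

  IsImage-inside : Injective _≡_ _≡_ φ → IsImage φ (inside ∷ A) B →
                   IsImage (φ ∘ suc) A (B - φ zero)
  IsImage-inside φ-inj img w = mk⇔
    (λ w∈B-φ0 → drop-zero (x∈p-y⇒x≢y w∈B-φ0) (Equivalence.to (img w) (p─q⊆p B _ w∈B-φ0)))
    (λ (v , v∈A , φv≡w) → x∈p∧x≢y⇒x∈p-y
       (Equivalence.from (img w) (suc v , there v∈A , φv≡w))
       (λ w≡φ0 → suc≢zero (φ-inj (trans φv≡w w≡φ0))))
    where
    suc≢zero : ∀ {v : Fin m} → suc v ≢ zero
    suc≢zero ()
    drop-zero : w ≢ φ zero → Σ (Fin (suc m)) (λ v → v ∈ inside ∷ A × φ v ≡ w) →
                Σ (Fin m) (λ v → v ∈ A × φ (suc v) ≡ w)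
    drop-zero w≢φ0 (zero  , _          , φ0≡w) = ⊥-elim (w≢φ0 (sym φ0≡w))
    drop-zero _    (suc v , there v∈A , φv≡w) = v , v∈A , φv≡w

IsImage⇒∣A∣≡∣B∣ : ∀ {m k} {φ : Fin m → Fin k} → Injective _≡_ _≡_ φ →
                   ∀ {A B} → IsImage φ A B → ∣ A ∣ ≡ ∣ B ∣
IsImage⇒∣A∣≡∣B∣ {zero} _ {Vec.[]} img =
  sym (Empty⇒∣p∣≡0 (λ (w , w∈B) → no-preimage (Equivalence.to (img w) w∈B)))
  where
  no-preimage : ∀ {P : Fin 0 → Set} → Σ (Fin 0) P → ⊥
  no-preimage (() , _)
IsImage⇒∣A∣≡∣B∣ {suc m} φ-inj {outside ∷ A} img =
  IsImage⇒∣A∣≡∣B∣ (suc-injective ∘ φ-inj) (IsImage-outside img)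
IsImage⇒∣A∣≡∣B∣ {suc m} {φ = φ} φ-inj {inside ∷ A} {B} img = begin
  suc ∣ A ∣           ≡⟨ cong suc (IsImage⇒∣A∣≡∣B∣ (suc-injective ∘ φ-inj) (IsImage-inside φ-inj img)) ⟩
  suc ∣ B - φ zero ∣  ≡⟨ sym (x∈p⇒∣p∣≡1+∣p-x∣ (Equivalence.from (img (φ zero)) (zero , here , refl))) ⟩
  ∣ B ∣               ∎
  where open ≡-Reasoning

Uniform : ∀ {k} → ℕ → List (Subset k) → Set
Uniform s fs = All (λ f → ∣ f ∣ ≡ s) fs

AvoidsSizes : ∀ {k} → List ℕ → Subset k → Set
AvoidsSizes S f = All (∣ f ∣ ≢_) S

module _ {k : ℕ} {fs : List (Subset k)} {H : MultiHypergraph} where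

  ContainsCopy⇒edge-size-occurs : ContainsCopy fs H →
    ∀ i → Any (λ f → ∣ f ∣ ≡ ∣ lookup (edges H) i ∣) fs
  ContainsCopy⇒edge-size-occurs (φ , φ-inj , ψ , _ , img) i =
    Any.map (λ ψi≡f → trans (cong ∣_∣ (sym ψi≡f)) (sym (IsImage⇒∣A∣≡∣B∣ φ-inj (img i))))
            (∈-lookup (ψ i))

  Uniform⇒¬ContainsCopy : ∀ {s} → NonUniform H → Uniform s fs → ¬ ContainsCopy fs H
  Uniform⇒¬ContainsCopy {s} (i , j , ∣Hᵢ∣≢∣Hⱼ∣) uniform copy =
    ∣Hᵢ∣≢∣Hⱼ∣ (trans (sym (s≡size i)) (s≡size j))
    where
    s≡size : ∀ i → s ≡ ∣ lookup (edges H) i ∣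
    s≡size i with (≡s , ≡Hᵢ) ← All.lookupAny uniform (ContainsCopy⇒edge-size-occurs copy i) =
      trans (sym ≡s) ≡Hᵢ

  avoids-edge-size⇒¬ContainsCopy : ∀ i → All (λ f → ∣ f ∣ ≢ ∣ lookup (edges H) i ∣) fs →
                                   ¬ ContainsCopy fs H
  avoids-edge-size⇒¬ContainsCopy i avoids copy =
    All¬⇒¬Any avoids (ContainsCopy⇒edge-size-occurs copy i)

chosenSizes : ∀ {ℋ} → All NonUniform ℋ → List ℕ
chosenSizes All.[] = []
chosenSizes {H ∷ _} (nu All.∷ nus) = ∣ lookup (edges H) (proj₁ nu) ∣ ∷ chosenSizes nus

length-chosenSizes : ∀ {ℋ} (nus : All NonUniform ℋ) → length (chosenSizes nus) ≡ length ℋ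
length-chosenSizes All.[]         = refl
length-chosenSizes (_ All.∷ nus) = cong suc (length-chosenSizes nus)

module _ {k : ℕ} {fs : List (Subset k)} where

  Uniform⇒Free : ∀ {ℋ s} → All NonUniform ℋ → Uniform s fs → Free fs ℋ
  Uniform⇒Free nus uniform =
    All¬⇒¬Any (All.map (λ {H} nu → Uniform⇒¬ContainsCopy {H = H} nu uniform) nus)

  AvoidsChosenSizes⇒Free : ∀ {ℋ} (nus : All NonUniform ℋ) →
                           All (AvoidsSizes (chosenSizes nus)) fs → Free fs ℋ
  AvoidsChosenSizes⇒Free {H ∷ _} (nu All.∷ _) avoids (Any.here copy) =
    avoids-edge-size⇒¬ContainsCopy {H = H} (proj₁ nu) (All.map All.head avoids) copy
  AvoidsChosenSizes⇒Free (_ All.∷ nus) avoids (Any.there copy) =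
    AvoidsChosenSizes⇒Free nus (All.map All.tail avoids) copy

length-filter+filter-∁ : ∀ {a p} {X : Set a} {P : X → Set p} (P? : Decidable P) xs →
                         length xs ≡ length (filter P? xs) + length (filter (∁? P?) xs)
length-filter+filter-∁ P? []       = refl
length-filter+filter-∁ P? (x ∷ xs) with ih ← length-filter+filter-∁ P? xs | does (P? x)
... | true  = cong suc ih
... | false = trans (cong suc ih) (sym (+-suc _ _))

module _ {G : MultiHypergraph} {ℋ : List MultiHypergraph} {k : ℕ} (ex : ExLess G ℋ k)
         (uniform⇒free : ∀ {s} {fs : List (Subset (n G))} → Uniform s fs → Free fs ℋ) where

  -- The freeness hypothesis ranges over sublists of xs so that it survives the recursion
  -- into the edges of size ≠ s, whose sublists avoid s as well.
  length≤sizeClasses : ∀ S xs → xs ⊆ edges G →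
    (∀ ys → ys ⊆ xs → All (AvoidsSizes S) ys → Free ys ℋ) →
    length xs ≤ suc (length S) * (k ∸ 1)
  length≤sizeClasses [] xs xs⊆G avoiders-free = begin
    length xs      ≤⟨ <⇒≤pred (ex xs xs⊆G (avoiders-free xs ⊆-refl (All.universal (λ _ → All.[]) xs))) ⟩
    k ∸ 1          ≡⟨ sym (*-identityˡ (k ∸ 1)) ⟩
    1 * (k ∸ 1)    ∎
    where open ≤-Reasoning
  length≤sizeClasses (s ∷ S) xs xs⊆G avoiders-free = begin
    length xs                                  ≡⟨ length-filter+filter-∁ size≟s xs ⟩
    length sized + length others               ≤⟨ +-mono-≤ sized-bound others-bound ⟩
    (k ∸ 1) + suc (length S) * (k ∸ 1)         ∎
    where
    open ≤-Reasoning
    size≟s : Decidable (λ (f : Subset (n G)) → ∣ f ∣ ≡ s)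
    size≟s f = ∣ f ∣ ≟ s
    sized others : List (Subset (n G))
    sized  = filter size≟s xs
    others = filter (∁? size≟s) xs
    sized-bound : length sized ≤ k ∸ 1
    sized-bound = <⇒≤pred (ex sized (⊆-trans (filter-⊆ size≟s xs) xs⊆G)
                                    (uniform⇒free (all-filter size≟s xs)))
    others-bound : length others ≤ suc (length S) * (k ∸ 1)
    others-bound = length≤sizeClasses S others (⊆-trans (filter-⊆ (∁? size≟s) xs) xs⊆G)
      λ ys ys⊆others avoids → avoiders-free ys (⊆-trans ys⊆others (filter-⊆ (∁? size≟s) xs))
        (All.zipWith (λ (≢s , avoids-S) → ≢s All.∷ avoids-S)
                     (All-resp-⊆ ys⊆others (all-filter (∁? size≟s) xs) , avoids))

EStarLe-nonUniform : ∀ ℋ → All NonUniform ℋ → ∀ k → EStarLe ℋ k (suc (length ℋ) * (k ∸ 1))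
EStarLe-nonUniform ℋ nus k G ex = begin
  e G                                        ≤⟨ length≤sizeClasses {G} {ℋ} {k} ex
                                                  (λ {_} {fs} → Uniform⇒Free {fs = fs} nus)
                                                  (chosenSizes nus) (edges G) ⊆-refl
                                                  (λ ys _ → AvoidsChosenSizes⇒Free nus) ⟩
  suc (length (chosenSizes nus)) * (k ∸ 1)   ≡⟨ cong (λ m → suc m * (k ∸ 1)) (length-chosenSizes nus) ⟩
  suc (length ℋ) * (k ∸ 1)                   ∎
  where open ≤-Reasoning

proposition4p1 : (∀ (H : MultiHypergraph) → NonUniform H →
    ∀ (k : ℕ) → 1 Data.Nat.≤ k → EStarLe [ H ] k (2 * (k ∸ 1)))
    × (∀ (ℋ : List MultiHypergraph) → All NonUniform ℋ →
    ∀ (k : ℕ) → EStarFinite ℋ k)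
proposition4p1 =
    (λ H nu k _ → EStarLe-nonUniform [ H ] (nu All.∷ All.[]) k)
  , (λ ℋ nus k → _ , EStarLe-nonUniform ℋ nus k)
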